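{- Let $G$ be a connected graph on $n \ge 2$ vertices, and let $\overline{G}$ denote its complement. (a) If $\overline{G}$ is connected, then $\operatorname{fd}(G) = \operatorname{fd}(\overline{G})$. (b) If $\overline{G}$ has $q \ge 2$ components, then $\operatorname{fd}(G) \le n/q \le n/2$.
   Context: All graphs are finite and simple; $N(v)$ denotes the open neighborhood of $v$. For a graph $G=(V,E)$ and an integer $k \ge 1$, a $k$-fair dominating set is a dominating set $D \subseteq V$ such that $|N(v) \cap D| = k$ for every $v \in V \setminus D$ (the set $D = V$ qualifies vacuously). A fair dominating set (FD-set) is a set that is a $k$-fair dominating set for some $k \ge 1$. If $G$ has at least one edge, $\operatorname{fd}(G)$ is the minimum cardinality of an FD-set of $G$; by convention, $\operatorname{fd}(\overline{K_n}) = n$ for the edgeless graph on $n$ vertices. -}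

module Defs where

open import Data.Nat using (ℕ; zero; suc; _≤_; _+_; _*_)
open import Data.Bool using (Bool; true; false; not; if_then_else_)
open import Data.Fin using (Fin; _≟_)
open import Data.Fin.Subset using (Subset; _∈_; _∉_; _∩_; ∣_∣)
open import Data.Vec using (tabulate)
open import Data.Product using (Σ; ∃; _×_; _,_)
open import Data.Empty using (⊥-elim)
open import Relation.Nullary using (yes; no)
open import Relation.Binary.PropositionalEquality using (_≡_; refl)
open import Relation.Binary.Construct.Closure.ReflexiveTransitive using (Star)
open import Function.Definitions using (Surjective)

record Graph (n : ℕ) : Set where
  field
    adj    : Fin n → Fin n → Bool
    adjSym : ∀ u v → adj u v ≡ adj v u
    irrefl : ∀ v → adj v v ≡ false
open Graph public

Adj : ∀ {n} → Graph n → Fin n → Fin n → Set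
Adj G u v = adj G u v ≡ true

compAdj : ∀ {n} → Graph n → Fin n → Fin n → Bool
compAdj G u v with u ≟ v
... | yes _ = false
... | no  _ = not (adj G u v)

private
  compSym : ∀ {n} (G : Graph n) u v → compAdj G u v ≡ compAdj G v u
  compSym G u v with u ≟ v | v ≟ u
  ... | yes _ | yes _ = refl
  ... | yes refl | no v≢u = ⊥-elim (v≢u refl)
  ... | no u≢v | yes refl = ⊥-elim (u≢v refl)
  ... | no _ | no _ rewrite Graph.adjSym G u v = refl

  compIrr : ∀ {n} (G : Graph n) v → compAdj G v v ≡ false
  compIrr G v with v ≟ v
  ... | yes _ = refl
  ... | no v≢v = ⊥-elim (v≢v refl)

complement : ∀ {n} → Graph n → Graph n
complement G = record { adj = compAdj G ; adjSym = compSym G ; irrefl = compIrr G }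

Reach : ∀ {n} → Graph n → Fin n → Fin n → Set
Reach G = Star (Adj G)

Connected : ∀ {n} → Graph n → Set
Connected G = ∀ u v → Reach G u v

-- G has exactly q connected components: there is a surjective labelling
-- of the vertices by Fin q whose fibres are exactly the reachability classes.
HasComponents : ∀ {n} → Graph n → ℕ → Set
HasComponents {n} G q =
  Σ (Fin n → Fin q) λ c →
    Surjective _≡_ _≡_ c ×
    (∀ u v → (c u ≡ c v → Reach G u v) × (Reach G u v → c u ≡ c v))

N : ∀ {n} → Graph n → Fin n → Subset n
N G v = tabulate (adj G v)

Dominating : ∀ {n} → Graph n → Subset n → Set
Dominating G D = ∀ v → v ∉ D → ∃ λ u → u ∈ D × Adj G v u

KFairDominating : ∀ {n} → Graph n → ℕ → Subset n → Set
KFairDominating G k D = Dominating G D × (∀ v → v ∉ D → ∣ N G v ∩ D ∣ ≡ k)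

FairDominating : ∀ {n} → Graph n → Subset n → Set
FairDominating G D = Σ ℕ λ k → 1 ≤ k × KFairDominating G k D

-- m = fd(G): m is the minimum cardinality of an FD-set of G.
-- (For the edgeless graph this minimum equals n, matching the convention.)
IsFd : ∀ {n} → Graph n → ℕ → Set
IsFd G m = (Σ _ λ D → FairDominating G D × ∣ D ∣ ≡ m)
         × (∀ D → FairDominating G D → m ≤ ∣ D ∣)

-- If G and its complement H are both connected, the fair dominating sets of
-- G and H coincide: for a vertex v outside D the two neighbourhoods of v
-- partition D, so a k-fair set of G is (|D| − k)-fair in H, and |D| − k > 0
-- because a walk in H from a vertex outside D to one inside must cross into
-- D.  If H has q components, each component C is completely joined in G to
-- the rest of the graph and is therefore |C|-fair in G; as the components
-- partition the n vertices, fd(G) · q ≤ n.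
module Submission where

open import Defs
open import Data.Bool using (Bool; true; false; not)
open import Data.Bool.Properties using (not-involutive; ∧-zeroʳ; ∧-identityʳ)
open import Data.Fin using (Fin; _≟_)
open import Data.Fin.Properties using (all?; ¬∀⟶∃¬)
open import Data.Fin.Subset using (Subset; _∈_; _∉_; _∩_; ∣_∣; ⁅_⁆; Nonempty; inside; outside)
open import Data.Fin.Subset.Properties
  using (_∈?_; nonempty?; Empty-unique; ∣⊥∣≡0; ∣p∣≤∣x∷p∣; ∣⁅x⁆∣≡1; p⊆q⇒∣p∣≤∣q∣; ∣p∩q∣≤∣q∣; x∈p∩q⁺; x∈p∩q⁻; x∈⁅x⁆; x∈⁅y⁆⇒x≡y)
open import Data.Nat using (ℕ; zero; suc; _≤_; _+_; _*_; z≤n; s≤s)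
open import Data.Nat.Properties using (≤-refl; ≤-antisym; *-identityʳ; ≤-trans; +-suc; +-cancelʳ-≡; +-mono-≤; *-comm; *-monoʳ-≤; +-0-commutativeMonoid; module ≤-Reasoning)
open import Data.Product using (∃₂; _×_; _,_; proj₁; proj₂)
open import Data.Vec using (_∷_; []; lookup; tabulate; here; there)
open import Data.Vec.Properties using (lookup∘tabulate; []=⇒lookup; lookup⇒[]=)
open import Function using (_∘_)
open import Relation.Binary.Construct.Closure.ReflexiveTransitive using (Star; ε; _◅_)
open import Relation.Nullary using (¬_; yes; no; contradiction)
open import Relation.Unary using (Decidable)
open import Relation.Binary.PropositionalEquality

open import Algebra.Properties.CommutativeMonoid.Sum +-0-commutativeMonoid using (sum; sum-syntax; ∑-comm; sum-cong-≗)

private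
  variable
    n q k : ℕ

χ : Bool → ℕ
χ true  = 1
χ false = 0

∑-const : ∀ n a → sum {n} (λ _ → a) ≡ n * a
∑-const zero    a = refl
∑-const (suc n) a = cong (a +_) (∑-const n a)

n*a≤∑ : ∀ {n} {a} (f : Fin n → ℕ) → (∀ i → a ≤ f i) → n * a ≤ sum f
n*a≤∑ {zero}  f a≤f = z≤n
n*a≤∑ {suc n} f a≤f = +-mono-≤ (a≤f Fin.zero) (n*a≤∑ (f ∘ Fin.suc) (a≤f ∘ Fin.suc))

∣p∣≡∑χ : (p : Subset n) → ∣ p ∣ ≡ sum (χ ∘ lookup p)
∣p∣≡∑χ []            = refl
∣p∣≡∑χ (inside  ∷ p) = cong suc (∣p∣≡∑χ p)
∣p∣≡∑χ (outside ∷ p) = ∣p∣≡∑χ p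

∣tabulate∣≡∑χ : (f : Fin n → Bool) → ∣ tabulate f ∣ ≡ sum (χ ∘ f)
∣tabulate∣≡∑χ f = trans (∣p∣≡∑χ (tabulate f)) (sum-cong-≗ (cong χ ∘ lookup∘tabulate f))

x∈p⇒1≤∣p∣ : {x : Fin n} {p : Subset n} → x ∈ p → 1 ≤ ∣ p ∣
x∈p⇒1≤∣p∣ here                          = s≤s z≤n
x∈p⇒1≤∣p∣ (there {y = s} {xs = p} x∈p) = ≤-trans (x∈p⇒1≤∣p∣ x∈p) (∣p∣≤∣x∷p∣ s p)

1≤∣p∣⇒Nonempty : (p : Subset n) → 1 ≤ ∣ p ∣ → Nonempty p
1≤∣p∣⇒Nonempty {n} p 1≤∣p∣ with nonempty? p
... | yes ne = ne
... | no  ¬ne with () ← subst (1 ≤_) (trans (cong ∣_∣ (Empty-unique ¬ne)) (∣⊥∣≡0 n)) 1≤∣p∣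

∣p∩r∣+∣q∩r∣≡∣r∣ : (p q r : Subset n) → (∀ {i} → i ∈ r → lookup p i ≡ not (lookup q i)) →
                  ∣ p ∩ r ∣ + ∣ q ∩ r ∣ ≡ ∣ r ∣
∣p∩r∣+∣q∩r∣≡∣r∣ [] [] [] _ = refl
∣p∩r∣+∣q∩r∣≡∣r∣ (x ∷ p) (y ∷ q) (outside ∷ r) split
  rewrite ∧-zeroʳ x | ∧-zeroʳ y = ∣p∩r∣+∣q∩r∣≡∣r∣ p q r (split ∘ there)
∣p∩r∣+∣q∩r∣≡∣r∣ (x ∷ p) (y ∷ q) (inside ∷ r) split
  rewrite ∧-identityʳ x | ∧-identityʳ y | split here with y
... | false = cong suc (∣p∩r∣+∣q∩r∣≡∣r∣ p q r (split ∘ there))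
... | true  = trans (+-suc _ _) (cong suc (∣p∩r∣+∣q∩r∣≡∣r∣ p q r (split ∘ there)))

Star-crossing : ∀ {a r p} {A : Set a} {R : A → A → Set r} {P : A → Set p} → Decidable P →
                ∀ {x y} → Star R x y → ¬ P x → P y → ∃₂ λ u v → ¬ P u × P v × R u v
Star-crossing P? ε              ¬Px Py = contradiction Py ¬Px
Star-crossing P? (_◅_ {j = w} xRw w⋆y) ¬Px Py with P? w
... | yes Pw  = _ , w , ¬Px , Pw , xRw
... | no  ¬Pw = Star-crossing P? w⋆y ¬Pw Py

∈N⇒Adj : (G : Graph n) {v u : Fin n} → u ∈ N G v → Adj G v u
∈N⇒Adj G {v} {u} u∈N = trans (sym (lookup∘tabulate (adj G v) u)) ([]=⇒lookup u∈N)

Adj⇒∈N : (G : Graph n) {v u : Fin n} → Adj G v u → u ∈ N G v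
Adj⇒∈N G {v} {u} vu = lookup⇒[]= u (N G v) (trans (lookup∘tabulate (adj G v) u) vu)

fair⇒FairDominating : (G : Graph n) {D : Subset n} → 1 ≤ k →
                      (∀ v → v ∉ D → ∣ N G v ∩ D ∣ ≡ k) → FairDominating G D
fair⇒FairDominating {k = k} G {D} 1≤k fair = k , 1≤k , dominating , fair
  where
  dominating : Dominating G D
  dominating v v∉D with 1≤∣p∣⇒Nonempty (N G v ∩ D) (subst (1 ≤_) (sym (fair v v∉D)) 1≤k)
  ... | u , u∈N∩D = u , proj₂ (x∈p∩q⁻ _ _ u∈N∩D) , ∈N⇒Adj G (proj₁ (x∈p∩q⁻ _ _ u∈N∩D))

record Complementary (G H : Graph n) : Set where
  constructor flips
  field
    flip : ∀ u v → u ≢ v → adj H u v ≡ not (adj G u v)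
open Complementary

complement-complementary : (G : Graph n) → Complementary G (complement G)
complement-complementary G = flips flip′
  where
  flip′ : ∀ u v → u ≢ v → compAdj G u v ≡ not (adj G u v)
  flip′ u v u≢v with u ≟ v
  ... | yes u≡v = contradiction u≡v u≢v
  ... | no  _   = refl

complementary-sym : {G H : Graph n} → Complementary G H → Complementary H G
complementary-sym {G = G} (flips GH) = flips λ u v u≢v →
  trans (sym (not-involutive (adj G u v))) (cong not (sym (GH u v u≢v)))

complementary-¬Adj⇒Adj : {G H : Graph n} → Complementary G H →
                         ∀ {u v} → u ≢ v → ¬ Adj H u v → Adj G u v
complementary-¬Adj⇒Adj {G = G} {H} GH {u} {v} u≢v ¬Huv
  rewrite flip (complementary-sym GH) u v u≢v with adj H u v
... | false = refl
... | true  = contradiction refl ¬Huv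

complementary-∣N∩D∣ : {G H : Graph n} → Complementary G H → (D : Subset n) →
                      ∀ v → v ∉ D → ∣ N H v ∩ D ∣ + ∣ N G v ∩ D ∣ ≡ ∣ D ∣
complementary-∣N∩D∣ {G = G} {H} GH D v v∉D = ∣p∩r∣+∣q∩r∣≡∣r∣ (N H v) (N G v) D split
  where
  split : ∀ {u} → u ∈ D → lookup (N H v) u ≡ not (lookup (N G v) u)
  split {u} u∈D rewrite lookup∘tabulate (adj H v) u | lookup∘tabulate (adj G v) u =
    flip GH v u λ { refl → v∉D u∈D }

complementary-FairDominating : {G H : Graph n} → Complementary G H → Connected H →
                               ∀ {D} → FairDominating G D → FairDominating H D
complementary-FairDominating {n} {G} {H} GH H-connected {D} (k , 1≤k , G-dominating , G-fair)
  with all? (_∈? D)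
... | yes D≡V = fair⇒FairDominating H (≤-refl {1}) λ v v∉D → contradiction (D≡V v) v∉D
... | no  D≢V with ¬∀⟶∃¬ n (_∈ D) (_∈? D) D≢V
... | v₀ , v₀∉D = fair⇒FairDominating H 1≤k′ H-fair
  where
  k′ : ℕ
  k′ = ∣ N H v₀ ∩ D ∣

  H-fair : ∀ v → v ∉ D → ∣ N H v ∩ D ∣ ≡ k′
  H-fair v v∉D = +-cancelʳ-≡ k _ _ (begin
    ∣ N H v ∩ D ∣ + k                ≡⟨ cong (_ +_) (sym (G-fair v v∉D)) ⟩
    ∣ N H v ∩ D ∣ + ∣ N G v ∩ D ∣    ≡⟨ complementary-∣N∩D∣ GH D v v∉D ⟩
    ∣ D ∣                            ≡⟨ sym (complementary-∣N∩D∣ GH D v₀ v₀∉D) ⟩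
    k′ + ∣ N G v₀ ∩ D ∣              ≡⟨ cong (k′ +_) (G-fair v₀ v₀∉D) ⟩
    k′ + k                           ∎)
    where open ≡-Reasoning

  1≤k′ : 1 ≤ k′
  1≤k′ with G-dominating v₀ v₀∉D
  ... | u , u∈D , _ with Star-crossing (_∈? D) (H-connected v₀ u) v₀∉D u∈D
  ... | a , b , a∉D , b∈D , ab =
    subst (1 ≤_) (H-fair a a∉D) (x∈p⇒1≤∣p∣ (x∈p∩q⁺ (Adj⇒∈N H ab , b∈D)))

IsFd-unique : {G H : Graph n} →
              (∀ {D} → FairDominating G D → FairDominating H D) →
              (∀ {D} → FairDominating H D → FairDominating G D) →
              ∀ {m m′} → IsFd G m → IsFd H m′ → m ≡ m′
IsFd-unique G⇒H H⇒G ((D , D-fd , ∣D∣≡m) , G-min) ((D′ , D′-fd , ∣D′∣≡m′) , H-min) =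
  ≤-antisym (subst (_ ≤_) ∣D′∣≡m′ (G-min D′ (H⇒G D′-fd)))
            (subst (_ ≤_) ∣D∣≡m  (H-min D  (G⇒H D-fd)))

joined⇒FairDominating : (G : Graph n) {C : Subset n} → Nonempty C →
                        (∀ {v u} → v ∉ C → u ∈ C → Adj G v u) → FairDominating G C
joined⇒FairDominating G {C} (x , x∈C) joined =
  fair⇒FairDominating G (x∈p⇒1≤∣p∣ x∈C) λ v v∉C →
    ≤-antisym (∣p∩q∣≤∣q∣ (N G v) C)
              (p⊆q⇒∣p∣≤∣q∣ λ u∈C → x∈p∩q⁺ (Adj⇒∈N G (joined v∉C u∈C) , u∈C))

fibre : (Fin n → Fin q) → Fin q → Subset n
fibre c j = tabulate (λ v → lookup ⁅ c v ⁆ j)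

∈fibre⁻ : (c : Fin n → Fin q) {j : Fin q} {v : Fin n} → v ∈ fibre c j → c v ≡ j
∈fibre⁻ c {j} {v} v∈ = sym (x∈⁅y⁆⇒x≡y (c v) (lookup⇒[]= j ⁅ c v ⁆
  (trans (sym (lookup∘tabulate (λ w → lookup ⁅ c w ⁆ j) v)) ([]=⇒lookup v∈))))

∈fibre⁺ : (c : Fin n → Fin q) {j : Fin q} {v : Fin n} → c v ≡ j → v ∈ fibre c j
∈fibre⁺ c {v = v} refl = lookup⇒[]= v (fibre c (c v))
  (trans (lookup∘tabulate (λ w → lookup ⁅ c w ⁆ (c v)) v) ([]=⇒lookup (x∈⁅x⁆ (c v))))

∑∣fibre∣≡n : (c : Fin n → Fin q) → sum (λ j → ∣ fibre c j ∣) ≡ n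
∑∣fibre∣≡n {n} {q} c = begin
  sum (λ j → ∣ fibre c j ∣)
    ≡⟨ sum-cong-≗ (λ j → ∣tabulate∣≡∑χ (λ v → lookup ⁅ c v ⁆ j)) ⟩
  ∑[ j < q ] ∑[ v < n ] χ (lookup ⁅ c v ⁆ j)
    ≡⟨ ∑-comm (λ j v → χ (lookup ⁅ c v ⁆ j)) ⟩
  ∑[ v < n ] ∑[ j < q ] χ (lookup ⁅ c v ⁆ j)
    ≡⟨ sum-cong-≗ (λ v → trans (sym (∣p∣≡∑χ ⁅ c v ⁆)) (∣⁅x⁆∣≡1 (c v))) ⟩
  sum {n} (λ _ → 1)
    ≡⟨ ∑-const n 1 ⟩
  n * 1
    ≡⟨ *-identityʳ n ⟩
  n ∎
  where open ≡-Reasoning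

component-FairDominating : (G : Graph n) → ((c , _) : HasComponents (complement G) q) →
                           ∀ j → FairDominating G (fibre c j)
component-FairDominating {n} G (c , c-surjective , c-classes) j =
  joined⇒FairDominating G (x , ∈fibre⁺ c (proj₂ (c-surjective j) refl)) joined
  where
  x : Fin n
  x = proj₁ (c-surjective j)

  joined : ∀ {v u} → v ∉ fibre c j → u ∈ fibre c j → Adj G v u
  joined {v} {u} v∉C u∈C = complementary-¬Adj⇒Adj (complement-complementary G)
    (λ { refl → v∉C u∈C })
    (λ vu → v∉C (∈fibre⁺ c (trans (proj₂ (c-classes v u) (vu ◅ ε)) (∈fibre⁻ c u∈C))))

theorem1 : ∀ (n : ℕ) (G : Graph n) → 2 ≤ n → Connected G →
    ((Connected (complement G) → ∀ m m′ → IsFd G m → IsFd (complement G) m′ → m ≡ m′)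
    × (∀ q → 2 ≤ q → HasComponents (complement G) q →
        ∀ m → IsFd G m → (m * q ≤ n) × (n * 2 ≤ n * q)))
theorem1 n G _ G-connected = equal-fd , components-bound
  where
  G↔Ḡ : Complementary G (complement G)
  G↔Ḡ = complement-complementary G

  equal-fd : Connected (complement G) → ∀ m m′ → IsFd G m → IsFd (complement G) m′ → m ≡ m′
  equal-fd Ḡ-connected m m′ = IsFd-unique {G = G} {complement G}
    (complementary-FairDominating G↔Ḡ Ḡ-connected)
    (complementary-FairDominating (complementary-sym G↔Ḡ) G-connected)

  components-bound : ∀ q → 2 ≤ q → HasComponents (complement G) q →
                     ∀ m → IsFd G m → (m * q ≤ n) × (n * 2 ≤ n * q)
  components-bound q 2≤q comps@(c , _) m (_ , minimal) = fd-bound , *-monoʳ-≤ n 2≤q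
    where
    fd-bound : m * q ≤ n
    fd-bound = begin
      m * q                      ≡⟨ *-comm m q ⟩
      q * m                      ≤⟨ n*a≤∑ _ (λ j → minimal _ (component-FairDominating G comps j)) ⟩
      sum (λ j → ∣ fibre c j ∣)  ≡⟨ ∑∣fibre∣≡n c ⟩
      n                          ∎
      where open ≤-Reasoning
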